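{- For all $n\geq 1$, $G_{n,1}=\widetilde{G}_{n-1,k-1}$.
   Context: Fix $k\geq 2$, letters $a_1,\dots,a_k$ and positive integers $(d_i)_{i\geq1}$. Define $s_{1-k}=a_2,\dots,s_{ -1}=a_k,s_0=a_1$; $s_n=s_{n-1}^{d_n}\cdots s_0^{d_1}a_{n+1}$ for $1\leq n\leq k-1$; $s_n=s_{n-1}^{d_n}\cdots s_{n-k+1}^{d_{n-k+2}}s_{n-k}$ for $n\geq k$. Define $D_0=a_1^{d_1-1}$, $D_m=s_m^{d_{m+1}-1}s_{m-1}^{d_m}\cdots s_1^{d_2}s_0^{d_1}$ for $m\geq1$, and formally $D_{ -j}=a_{k+1-j}^{ -1}$ for $1\leq j\leq k$. Products involving inverse letters are computed in the free group on $\{a_1,\dots,a_k\}$. For $1\leq r\leq k-1$ and $n\geq0$, $G_{n,r}$ is defined by $s_n=D_{n-r}G_{n,r}$ (so $G_{n,r}=a_{k+1+n-r}s_n$ when $n<r$). $\widetilde{w}$ denotes the reversal of $w$. -}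

module Defs where

open import Data.Nat using (ℕ; zero; suc; _+_; _∸_; _≤?_)
open import Data.Bool using (Bool; true; false; not)
open import Data.Product using (_×_; _,_; proj₁; proj₂)
open import Data.List using (List; []; _∷_; [_]; _++_; concat; replicate; applyUpTo; map; reverse; foldr)
open import Relation.Nullary using (yes; no)
open import Relation.Binary.PropositionalEquality using (_≡_)
import Data.Nat.Properties as ℕP
import Data.Bool.Properties as BP

-- A signed letter: (i , true) is a_i, (i , false) is a_i⁻¹  (letters indexed 1..k).
Letter : Set
Letter = ℕ × Bool

Word : Set
Word = List Letter

inv : Word → Word
inv w = reverse (map (λ x → proj₁ x , not (proj₂ x)) w)

push : Letter → Word → Word
push x [] = x ∷ []
push x (y ∷ w) with proj₁ x ℕP.≟ proj₁ y | proj₂ x BP.≟ not (proj₂ y)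
... | yes _ | yes _ = w
... | _     | _     = x ∷ y ∷ w

reduce : Word → Word
reduce = foldr push []

-- equality in the free group: equal free reductions
FreeEq : Word → Word → Set
FreeEq u v = reduce u ≡ reduce v

pow : Word → ℕ → Word
pow w e = concat (replicate e w)

-- sF k d f n computes s_n correctly whenever n < f  (fuel for termination).
-- s_n = s_{n-1}^{d_n} ⋯ s_{n-c}^{d_{n-c+1}} · tail, with c = min(n, k-1) and
-- tail = a_{n+1} if n ≤ k-1, tail = s_{n-k} if n ≥ k.
sF : (k : ℕ) → (d : ℕ → ℕ) → ℕ → ℕ → Word
sF k d zero n = []
sF k d (suc f) zero = [ (1 , true) ]
sF k d (suc f) (suc m) with suc m ≤? k ∸ 1
... | yes _ = concat (applyUpTo (λ i → pow (sF k d f (suc m ∸ suc i)) (d (suc (suc m ∸ suc i)))) (suc m))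
              ++ [ (suc (suc m) , true) ]
... | no _  = concat (applyUpTo (λ i → pow (sF k d f (suc m ∸ suc i)) (d (suc (suc m ∸ suc i)))) (k ∸ 1))
              ++ sF k d f (suc m ∸ k)

s : (k : ℕ) → (d : ℕ → ℕ) → ℕ → Word
s k d n = sF k d (suc n) n

-- D_m for m ≥ 0:  s_m^{d_{m+1}-1} s_{m-1}^{d_m} ⋯ s_0^{d_1}   (D_0 = a_1^{d_1 - 1})
D : (k : ℕ) → (d : ℕ → ℕ) → ℕ → Word
D k d m = pow (s k d m) (d (suc m) ∸ 1)
          ++ concat (applyUpTo (λ i → pow (s k d (m ∸ suc i)) (d (m ∸ i))) m)

-- D_{-j} = a_{k+1-j}⁻¹  for 1 ≤ j ≤ k
Dneg : (k : ℕ) → ℕ → Word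
Dneg k j = [ (k + 1 ∸ j , false) ]

Dshift : (k : ℕ) → (d : ℕ → ℕ) → ℕ → ℕ → Word
Dshift k d n r with r ≤? n
... | yes _ = D k d (n ∸ r)
... | no _  = Dneg k (r ∸ n)

G : (k : ℕ) → (d : ℕ → ℕ) → ℕ → ℕ → Word
G k d n r = inv (Dshift k d n r) ++ s k d n

module Submission where

-- Write n = m + 1 and let  P_m = s_m^{d_{m+1}} s_{m-1}^{d_m} ⋯ s_0^{d_1} = s_m D_m.
-- The heart of the argument is that P_m and D_m are palindromes (proved by strong
-- induction on m).  Consequently  P_m = reverse (s_m D_m) = D_m · reverse s_m.
-- The recursion for s_{m+1} reads  s_{m+1} = P_m · E⁻¹  with  E = D_{m-(k-1)},
-- literally (E = a_{m+2}⁻¹ when m < k-1) or after free cancellation (when m ≥ k-1,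
-- where P_m = s_{m+1} E); in both cases E is a palindrome.  Hence
--   G_{m+1,1} = D_m⁻¹ s_{m+1} = D_m⁻¹ D_m · reverse s_m · E⁻¹ = reverse (E⁻¹ s_m),
-- which is the reversal of G_{m,k-1} = E⁻¹ s_m.

open import Defs
open import Data.Nat using (ℕ; _≤_; _∸_)
open import Data.List using (reverse)

open import Data.Nat using (zero; suc; _+_; _<_; z≤n; s≤s; _≤?_; _<?_)
open import Data.Nat.Properties
open import Data.Nat.Induction using (<-rec)
open import Data.Bool using (true; not)
open import Data.Bool.Properties using (not-involutive)
import Data.Bool.Properties as Bool
open import Data.Product using (_×_; _,_; proj₁; proj₂)
open import Data.Unit using (⊤; tt)
open import Data.Empty using (⊥-elim)
open import Data.List using ([]; _∷_; [_]; _++_; concat; applyUpTo; map; foldr)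
open import Data.List.Properties
  using (++-assoc; ++-identityʳ; foldr-++; reverse-++; reverse-involutive; reverse-map; unfold-reverse)
open import Relation.Nullary using (¬_; yes; no; Dec)
open import Relation.Nullary.Decidable using (_×-dec_)
open import Relation.Binary.PropositionalEquality hiding ([_])
open ≡-Reasoning

inverse : Letter → Letter
inverse x = proj₁ x , not (proj₂ x)

Cancels : Letter → Letter → Set
Cancels x y = (proj₁ x ≡ proj₁ y) × (proj₂ x ≡ not (proj₂ y))

cancels? : ∀ x y → Dec (Cancels x y)
cancels? x y = (proj₁ x ≟ proj₁ y) ×-dec (proj₂ x Bool.≟ not (proj₂ y))

push-cancels : ∀ x y w → Cancels x y → push x (y ∷ w) ≡ w
push-cancels x y w (p , q) with proj₁ x ≟ proj₁ y | proj₂ x Bool.≟ not (proj₂ y)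
... | yes _ | yes _  = refl
... | no ¬p | _      = ⊥-elim (¬p p)
... | yes _ | no ¬q  = ⊥-elim (¬q q)

push-keeps : ∀ x y w → ¬ Cancels x y → push x (y ∷ w) ≡ x ∷ y ∷ w
push-keeps x y w ¬c with proj₁ x ≟ proj₁ y | proj₂ x Bool.≟ not (proj₂ y)
... | yes p | yes q = ⊥-elim (¬c (p , q))
... | no _  | yes _ = refl
... | no _  | no _  = refl
... | yes _ | no _  = refl

Reduced : Word → Set
Reduced []          = ⊤
Reduced (x ∷ [])    = ⊤
Reduced (x ∷ y ∷ w) = ¬ Cancels x y × Reduced (y ∷ w)

Reduced-tail : ∀ x w → Reduced (x ∷ w) → Reduced w
Reduced-tail x []      r = tt
Reduced-tail x (y ∷ w) r = proj₂ r

push-reduced : ∀ x w → Reduced w → Reduced (push x w)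
push-reduced x []      r = tt
push-reduced x (y ∷ w) r with cancels? x y
... | yes c rewrite push-cancels x y w c = Reduced-tail y w r
... | no ¬c rewrite push-keeps x y w ¬c  = ¬c , r

reduce-reduced : ∀ w → Reduced (reduce w)
reduce-reduced []      = tt
reduce-reduced (x ∷ w) = push-reduced x (reduce w) (reduce-reduced w)

-- On a reduced word, pushing y and then y⁻¹ changes nothing: either y was
-- absorbed (and y⁻¹ restores the absorbed letter) or y⁻¹ cancels y.
push-inverse : ∀ y w → Reduced w → push (inverse y) (push y w) ≡ w
push-inverse y []      r = push-cancels (inverse y) y [] (refl , refl)
push-inverse y (z ∷ w) r with cancels? y z
... | no ¬c rewrite push-keeps y z w ¬c = push-cancels (inverse y) y (z ∷ w) (refl , refl)
... | yes (p , q) rewrite push-cancels y z w (p , q) = restore z w r z≡y⁻¹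
  where
  z≡y⁻¹ : z ≡ inverse y
  z≡y⁻¹ = cong₂ _,_ (sym p) (trans (sym (not-involutive (proj₂ z))) (cong not (sym q)))
  restore : ∀ z w → Reduced (z ∷ w) → z ≡ inverse y → push (inverse y) w ≡ z ∷ w
  restore z []      r refl = refl
  restore z (u ∷ w) r refl = push-keeps (inverse y) u w (proj₁ r)

reduce-++ : ∀ u v → reduce (u ++ v) ≡ foldr push (reduce v) u
reduce-++ u v = foldr-++ push [] u v

reduce-congˡ : ∀ u {v v′} → reduce v ≡ reduce v′ → reduce (u ++ v) ≡ reduce (u ++ v′)
reduce-congˡ u {v} {v′} e = begin
  reduce (u ++ v)             ≡⟨ reduce-++ u v ⟩
  foldr push (reduce v) u     ≡⟨ cong (λ r → foldr push r u) e ⟩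
  foldr push (reduce v′) u    ≡⟨ reduce-++ u v′ ⟨
  reduce (u ++ v′)            ∎

inv-∷ : ∀ a A → inv (a ∷ A) ≡ inv A ++ [ inverse a ]
inv-∷ a A = unfold-reverse (inverse a) (map inverse A)

inv-cancelˡ : ∀ A B → reduce (inv A ++ (A ++ B)) ≡ reduce B
inv-cancelˡ []      B = refl
inv-cancelˡ (a ∷ A) B = begin
  reduce (inv (a ∷ A) ++ (a ∷ A ++ B))
    ≡⟨ cong (λ z → reduce (z ++ (a ∷ A ++ B))) (inv-∷ a A) ⟩
  reduce ((inv A ++ [ inverse a ]) ++ (a ∷ A ++ B))
    ≡⟨ cong reduce (++-assoc (inv A) [ inverse a ] (a ∷ A ++ B)) ⟩
  reduce (inv A ++ (inverse a ∷ a ∷ A ++ B))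
    ≡⟨ reduce-++ (inv A) (inverse a ∷ a ∷ A ++ B) ⟩
  foldr push (push (inverse a) (push a (reduce (A ++ B)))) (inv A)
    ≡⟨ cong (λ r → foldr push r (inv A)) (push-inverse a (reduce (A ++ B)) (reduce-reduced (A ++ B))) ⟩
  foldr push (reduce (A ++ B)) (inv A)
    ≡⟨ reduce-++ (inv A) (A ++ B) ⟨
  reduce (inv A ++ (A ++ B))
    ≡⟨ inv-cancelˡ A B ⟩
  reduce B ∎

inverse-involutive : ∀ x → inverse (inverse x) ≡ x
inverse-involutive (i , b) = cong (i ,_) (not-involutive b)

map-inverse-involutive : ∀ A → map inverse (map inverse A) ≡ A
map-inverse-involutive []      = refl
map-inverse-involutive (x ∷ A) = cong₂ _∷_ (inverse-involutive x) (map-inverse-involutive A)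

inv-involutive : ∀ A → inv (inv A) ≡ A
inv-involutive A = begin
  reverse (map inverse (reverse (map inverse A)))  ≡⟨ cong reverse (reverse-map inverse (map inverse A)) ⟩
  reverse (reverse (map inverse (map inverse A)))  ≡⟨ reverse-involutive _ ⟩
  map inverse (map inverse A)                      ≡⟨ map-inverse-involutive A ⟩
  A                                                ∎

inv-cancelʳ : ∀ X A → reduce ((X ++ A) ++ inv A) ≡ reduce X
inv-cancelʳ X A = begin
  reduce ((X ++ A) ++ inv A)          ≡⟨ cong reduce (++-assoc X A (inv A)) ⟩
  reduce (X ++ (A ++ inv A))          ≡⟨ cong (λ z → reduce (X ++ (A ++ z))) (++-identityʳ (inv A)) ⟨
  reduce (X ++ (A ++ (inv A ++ [])))  ≡⟨ reduce-congˡ X A⁻¹⁻¹A≈[] ⟩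
  reduce (X ++ [])                    ≡⟨ cong reduce (++-identityʳ X) ⟩
  reduce X                            ∎
  where
  A⁻¹⁻¹A≈[] : reduce (A ++ (inv A ++ [])) ≡ reduce []
  A⁻¹⁻¹A≈[] = subst (λ Y → reduce (Y ++ (inv A ++ [])) ≡ reduce []) (inv-involutive A)
                     (inv-cancelˡ (inv A) [])

Palindrome : Word → Set
Palindrome w = reverse w ≡ w

inv-palindrome : ∀ A → Palindrome A → Palindrome (inv A)
inv-palindrome A pal = begin
  reverse (reverse (map inverse A))  ≡⟨ reverse-involutive (map inverse A) ⟩
  map inverse A                      ≡⟨ cong (map inverse) pal ⟨
  map inverse (reverse A)            ≡⟨ reverse-map inverse A ⟩
  reverse (map inverse A)            ∎

pow-conjugate : ∀ A X Y → A ++ Y ≡ X ++ A → ∀ i → A ++ pow Y i ≡ pow X i ++ A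
pow-conjugate A X Y e zero    = ++-identityʳ A
pow-conjugate A X Y e (suc i) = begin
  A ++ (Y ++ pow Y i)    ≡⟨ ++-assoc A Y _ ⟨
  (A ++ Y) ++ pow Y i    ≡⟨ cong (_++ pow Y i) e ⟩
  (X ++ A) ++ pow Y i    ≡⟨ ++-assoc X A _ ⟩
  X ++ (A ++ pow Y i)    ≡⟨ cong (X ++_) (pow-conjugate A X Y e i) ⟩
  X ++ (pow X i ++ A)    ≡⟨ ++-assoc X _ A ⟨
  (X ++ pow X i) ++ A    ∎

reverse-pow : ∀ X i → reverse (pow X i) ≡ pow (reverse X) i
reverse-pow X zero    = refl
reverse-pow X (suc i) = begin
  reverse (X ++ pow X i)                 ≡⟨ reverse-++ X (pow X i) ⟩
  reverse (pow X i) ++ reverse X         ≡⟨ cong (_++ reverse X) (reverse-pow X i) ⟩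
  pow (reverse X) i ++ reverse X         ≡⟨ pow-conjugate (reverse X) (reverse X) (reverse X) refl i ⟨
  reverse X ++ pow (reverse X) i         ∎

Mirrors : Word → Word → Set
Mirrors A X = A ++ reverse X ≡ X ++ A

mirror-pow-palindrome : ∀ A X → Palindrome A → Mirrors A X → ∀ i → Palindrome (pow X i ++ A)
mirror-pow-palindrome A X pal mir i = begin
  reverse (pow X i ++ A)          ≡⟨ reverse-++ (pow X i) A ⟩
  reverse A ++ reverse (pow X i)  ≡⟨ cong₂ _++_ pal (reverse-pow X i) ⟩
  A ++ pow (reverse X) i          ≡⟨ pow-conjugate A X (reverse X) mir i ⟩
  pow X i ++ A                    ∎

mirror-extend : ∀ A c → Palindrome A → Palindrome c → Mirrors A (A ++ c)
mirror-extend A c palA palc = begin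
  A ++ reverse (A ++ c)        ≡⟨ cong (A ++_) (reverse-++ A c) ⟩
  A ++ (reverse c ++ reverse A) ≡⟨ cong₂ (λ u v → A ++ (u ++ v)) palc palA ⟩
  A ++ (c ++ A)                ≡⟨ ++-assoc A c A ⟨
  (A ++ c) ++ A                ∎

mirror-factor : ∀ A X c → Palindrome A → Palindrome c → A ≡ X ++ c → Mirrors A X
mirror-factor A X c palA palc A≡Xc = begin
  A ++ reverse X                ≡⟨ cong (_++ reverse X) A≡Xc ⟩
  (X ++ c) ++ reverse X         ≡⟨ ++-assoc X c _ ⟩
  X ++ (c ++ reverse X)         ≡⟨ cong (λ z → X ++ (z ++ reverse X)) palc ⟨
  X ++ (reverse c ++ reverse X) ≡⟨ cong (X ++_) (reverse-++ X c) ⟨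
  X ++ reverse (X ++ c)         ≡⟨ cong (λ z → X ++ reverse z) A≡Xc ⟨
  X ++ reverse A                ≡⟨ cong (X ++_) palA ⟩
  X ++ A                        ∎

applyUpTo-cong : ∀ {A : Set} {f g : ℕ → A} n → (∀ i → i < n → f i ≡ g i) →
                 applyUpTo f n ≡ applyUpTo g n
applyUpTo-cong zero    f≗g = refl
applyUpTo-cong (suc n) f≗g =
  cong₂ _∷_ (f≗g 0 (s≤s z≤n)) (applyUpTo-cong n (λ i i<n → f≗g (suc i) (s≤s i<n)))

∸-suc : ∀ m i → m ∸ suc i ≡ m ∸ 1 ∸ i
∸-suc m i = sym (∸-+-assoc m 1 i)

∸-<-suc : ∀ m i → i < m → m ∸ i ≡ suc (m ∸ 1 ∸ i)
∸-<-suc (suc m) i (s≤s i≤m) = +-∸-assoc 1 i≤m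

module Sequence (k′ : ℕ) (d : ℕ → ℕ) where

  k : ℕ
  k = suc k′

  S : ℕ → Word
  S = s k d

  fuel-irrelevant : ∀ f g n → n < f → n < g → sF k d f n ≡ sF k d g n
  powers-fuel-irrelevant : ∀ f g m c → m < f → m < g →
    concat (applyUpTo (λ i → pow (sF k d f (m ∸ i)) (d (suc (m ∸ i)))) c) ≡
    concat (applyUpTo (λ i → pow (sF k d g (m ∸ i)) (d (suc (m ∸ i)))) c)

  fuel-irrelevant (suc f) (suc g) zero    _         _         = refl
  fuel-irrelevant (suc f) (suc g) (suc m) (s≤s m<f) (s≤s m<g) with suc m ≤? k ∸ 1
  ... | yes _ = cong (_++ _) (powers-fuel-irrelevant f g m (suc m) m<f m<g)
  ... | no _  = cong₂ _++_ (powers-fuel-irrelevant f g m k′ m<f m<g)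
                  (fuel-irrelevant f g (m ∸ k′) (≤-<-trans (m∸n≤m m k′) m<f) (≤-<-trans (m∸n≤m m k′) m<g))

  powers-fuel-irrelevant f g m c m<f m<g = cong concat (applyUpTo-cong c λ i _ →
    cong (λ z → pow z (d (suc (m ∸ i))))
         (fuel-irrelevant f g (m ∸ i) (≤-<-trans (m∸n≤m m i) m<f) (≤-<-trans (m∸n≤m m i) m<g)))

  block : ℕ → ℕ → Word
  block m zero    = []
  block m (suc c) = pow (S m) (d (suc m)) ++ block (m ∸ 1) c

  block-applyUpTo : ∀ c m → concat (applyUpTo (λ i → pow (S (m ∸ i)) (d (suc (m ∸ i)))) c) ≡ block m c
  block-applyUpTo zero    m = refl
  block-applyUpTo (suc c) m = cong (pow (S m) (d (suc m)) ++_) (begin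
    concat (applyUpTo (λ i → pow (S (m ∸ suc i)) (d (suc (m ∸ suc i)))) c)
      ≡⟨ cong concat (applyUpTo-cong c (λ i _ → cong (λ j → pow (S j) (d (suc j))) (∸-suc m i))) ⟩
    concat (applyUpTo (λ i → pow (S (m ∸ 1 ∸ i)) (d (suc (m ∸ 1 ∸ i)))) c)
      ≡⟨ block-applyUpTo c (m ∸ 1) ⟩
    block (m ∸ 1) c ∎)

  block-in-s : ∀ c m → concat (applyUpTo (λ i → pow (sF k d (suc m) (m ∸ i)) (d (suc (m ∸ i)))) c) ≡ block m c
  block-in-s c m = trans (cong concat (applyUpTo-cong c λ i _ →
      cong (λ z → pow z (d (suc (m ∸ i)))) (fuel-irrelevant (suc m) (suc (m ∸ i)) (m ∸ i) (s≤s (m∸n≤m m i)) ≤-refl)))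
    (block-applyUpTo c m)

  s-short : ∀ m → m < k′ → S (suc m) ≡ block m (suc m) ++ [ (suc (suc m) , true) ]
  s-short m m<k′ with suc m ≤? k ∸ 1
  ... | yes _    = cong (_++ _) (block-in-s (suc m) m)
  ... | no m≮k′ = ⊥-elim (m≮k′ m<k′)

  s-long : ∀ m → k′ ≤ m → S (suc m) ≡ block m k′ ++ S (m ∸ k′)
  s-long m k′≤m with suc m ≤? k ∸ 1
  ... | yes m<k′ = ⊥-elim (≤⇒≯ k′≤m m<k′)
  ... | no _     = cong₂ _++_ (block-in-s k′ m)
                     (fuel-irrelevant (suc m) (suc (m ∸ k′)) (m ∸ k′) (s≤s (m∸n≤m m k′)) ≤-refl)

  D-block : ∀ m → D k d m ≡ pow (S m) (d (suc m) ∸ 1) ++ block (m ∸ 1) m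
  D-block m = cong (pow (S m) (d (suc m) ∸ 1) ++_) (begin
    concat (applyUpTo (λ i → pow (S (m ∸ suc i)) (d (m ∸ i))) m)
      ≡⟨ cong concat (applyUpTo-cong m λ i i<m →
           cong₂ (λ a b → pow (S a) (d b)) (∸-suc m i) (∸-<-suc m i i<m)) ⟩
    concat (applyUpTo (λ i → pow (S (m ∸ 1 ∸ i)) (d (suc (m ∸ 1 ∸ i)))) m)
      ≡⟨ block-applyUpTo m (m ∸ 1) ⟩
    block (m ∸ 1) m ∎)

  block-split : ∀ a b m → block m (a + b) ≡ block m a ++ block (m ∸ a) b
  block-split zero    b m = refl
  block-split (suc a) b m = begin
    pow (S m) (d (suc m)) ++ block (m ∸ 1) (a + b)
      ≡⟨ cong (pow (S m) (d (suc m)) ++_) (block-split a b (m ∸ 1)) ⟩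
    pow (S m) (d (suc m)) ++ (block (m ∸ 1) a ++ block (m ∸ 1 ∸ a) b)
      ≡⟨ cong (λ j → pow (S m) (d (suc m)) ++ (block (m ∸ 1) a ++ block j b)) (∸-suc m a) ⟨
    pow (S m) (d (suc m)) ++ (block (m ∸ 1) a ++ block (m ∸ suc a) b)
      ≡⟨ ++-assoc (pow (S m) (d (suc m))) (block (m ∸ 1) a) _ ⟨
    block m (suc a) ++ block (m ∸ suc a) b ∎

  P : ℕ → Word
  P m = block m (suc m)

  module Positive (d-pos : ∀ i → 1 ≤ i → 1 ≤ d i) where

    -- P_m = s_m D_m: split off one factor of s_m^{d_{m+1}} (here d_{m+1} ≥ 1 is used).
    P≡sD : ∀ m → P m ≡ S m ++ D k d m
    P≡sD m = begin
      pow (S m) (d (suc m)) ++ block (m ∸ 1) m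
        ≡⟨ cong (λ e → pow (S m) e ++ block (m ∸ 1) m) (m+[n∸m]≡n (d-pos (suc m) (s≤s z≤n))) ⟨
      (S m ++ pow (S m) (d (suc m) ∸ 1)) ++ block (m ∸ 1) m
        ≡⟨ ++-assoc (S m) _ _ ⟩
      S m ++ (pow (S m) (d (suc m) ∸ 1) ++ block (m ∸ 1) m)
        ≡⟨ cong (S m ++_) (D-block m) ⟨
      S m ++ D k d m ∎

    P≡s-next-D : ∀ m → k′ ≤ m → P m ≡ S (suc m) ++ D k d (m ∸ k′)
    P≡s-next-D m k′≤m = begin
      block m (suc m)                           ≡⟨ cong (block m) split ⟩
      block m (k′ + suc (m ∸ k′))               ≡⟨ block-split k′ (suc (m ∸ k′)) m ⟩
      block m k′ ++ P (m ∸ k′)                  ≡⟨ cong (block m k′ ++_) (P≡sD (m ∸ k′)) ⟩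
      block m k′ ++ (S (m ∸ k′) ++ D k d (m ∸ k′)) ≡⟨ ++-assoc (block m k′) _ _ ⟨
      (block m k′ ++ S (m ∸ k′)) ++ D k d (m ∸ k′) ≡⟨ cong (_++ D k d (m ∸ k′)) (s-long m k′≤m) ⟨
      S (suc m) ++ D k d (m ∸ k′)               ∎
      where
      split : suc m ≡ k′ + suc (m ∸ k′)
      split = trans (cong suc (sym (m+[n∸m]≡n k′≤m))) (sym (+-suc k′ (m ∸ k′)))

    BothPalindromes : ℕ → Set
    BothPalindromes n = Palindrome (P n) × Palindrome (D k d n)

    tail-mirrors : ∀ n → (∀ {j} → j < n → BothPalindromes j) →
                   Palindrome (block (n ∸ 1) n) × Mirrors (block (n ∸ 1) n) (S n)
    tail-mirrors zero    _  = refl , refl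
    tail-mirrors (suc m) ih = palP , mirror (m <? k′)
      where
      palP : Palindrome (P m)
      palP = proj₁ (ih (n<1+n m))
      mirror : Dec (m < k′) → Mirrors (P m) (S (suc m))
      mirror (yes m<k′) = subst (Mirrors (P m)) (sym (s-short m m<k′)) (mirror-extend (P m) _ palP refl)
      mirror (no m≮k′)  = mirror-factor (P m) (S (suc m)) (D k d (m ∸ k′)) palP
                            (proj₂ (ih (s≤s (m∸n≤m m k′)))) (P≡s-next-D m (≮⇒≥ m≮k′))

    -- P_n = s_n^{d_{n+1}} · tail and D_n = s_n^{d_{n+1}-1} · tail are palindromes.
    palindromic : ∀ n → BothPalindromes n
    palindromic = <-rec BothPalindromes λ n ih →
      let (palA , mir) = tail-mirrors n ih
          palPow = mirror-pow-palindrome (block (n ∸ 1) n) (S n) palA mir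
      in palPow (d (suc n)) , subst Palindrome (sym (D-block n)) (palPow (d (suc n) ∸ 1))

    P≡D-reverse-s : ∀ m → P m ≡ D k d m ++ reverse (S m)
    P≡D-reverse-s m = begin
      P m                              ≡⟨ proj₁ (palindromic m) ⟨
      reverse (P m)                    ≡⟨ cong reverse (P≡sD m) ⟩
      reverse (S m ++ D k d m)         ≡⟨ reverse-++ (S m) (D k d m) ⟩
      reverse (D k d m) ++ reverse (S m) ≡⟨ cong (_++ reverse (S m)) (proj₂ (palindromic m)) ⟩
      D k d m ++ reverse (S m)         ∎

Dshift-nonneg : ∀ k d n r → r ≤ n → Dshift k d n r ≡ D k d (n ∸ r)
Dshift-nonneg k d n r r≤n with r ≤? n
... | yes _   = refl
... | no r≰n = ⊥-elim (r≰n r≤n)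

Dshift-neg : ∀ k d n r → n < r → Dshift k d n r ≡ Dneg k (r ∸ n)
Dshift-neg k d n r n<r with r ≤? n
... | yes r≤n = ⊥-elim (<⇒≱ n<r r≤n)
... | no _    = refl

-- D_{m-(k-1)} = a_{k+1-(k-1-m)}⁻¹ = a_{m+2}⁻¹  when m < k - 1.
negative-index : ∀ m k′ → m < k′ → suc k′ + 1 ∸ (k′ ∸ m) ≡ suc (suc m)
negative-index m k′ m<k′ = begin
  suc k′ + 1 ∸ (k′ ∸ m)  ≡⟨ cong (_∸ (k′ ∸ m)) (+-comm (suc k′) 1) ⟩
  2 + k′ ∸ (k′ ∸ m)      ≡⟨ +-∸-assoc 2 (m∸n≤m k′ m) ⟩
  2 + (k′ ∸ (k′ ∸ m))    ≡⟨ cong (2 +_) (m∸[m∸n]≡n (<⇒≤ m<k′)) ⟩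
  suc (suc m)            ∎

module Step (k′ : ℕ) (d : ℕ → ℕ) (d-pos : ∀ i → 1 ≤ i → 1 ≤ d i) (m : ℕ) where
  open Sequence k′ d
  open Positive d-pos

  -- E = D_{m-(k-1)}, the word with  s_m = E · G_{m,k-1}.
  E : Word
  E = Dshift k d m k′

  E-palindrome : Palindrome E
  E-palindrome = by-cases (m <? k′)
    where
    by-cases : Dec (m < k′) → Palindrome E
    by-cases (yes m<k′) = subst Palindrome (sym (Dshift-neg k d m k′ m<k′)) refl
    by-cases (no m≮k′)  = subst Palindrome (sym (Dshift-nonneg k d m k′ (≮⇒≥ m≮k′)))
                                (proj₂ (palindromic (m ∸ k′)))

  s-next : reduce (S (suc m)) ≡ reduce (P m ++ inv E)
  s-next = by-cases (m <? k′)
    where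
    by-cases : Dec (m < k′) → reduce (S (suc m)) ≡ reduce (P m ++ inv E)
    by-cases (yes m<k′) = cong reduce (begin
      S (suc m)                         ≡⟨ s-short m m<k′ ⟩
      P m ++ [ (suc (suc m) , true) ]   ≡⟨ cong (λ i → P m ++ [ (i , true) ]) (negative-index m k′ m<k′) ⟨
      P m ++ inv (Dneg k (k′ ∸ m))      ≡⟨ cong (λ z → P m ++ inv z) (Dshift-neg k d m k′ m<k′) ⟨
      P m ++ inv E                      ∎)
    by-cases (no m≮k′) = begin
      reduce (S (suc m))                              ≡⟨ inv-cancelʳ (S (suc m)) E ⟨
      reduce ((S (suc m) ++ E) ++ inv E)              ≡⟨ cong (λ z → reduce ((S (suc m) ++ z) ++ inv E)) E≡D ⟩
      reduce ((S (suc m) ++ D k d (m ∸ k′)) ++ inv E) ≡⟨ cong (λ z → reduce (z ++ inv E)) (P≡s-next-D m k′≤m) ⟨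
      reduce (P m ++ inv E)                           ∎
      where
      k′≤m : k′ ≤ m
      k′≤m = ≮⇒≥ m≮k′
      E≡D : E ≡ D k d (m ∸ k′)
      E≡D = Dshift-nonneg k d m k′ k′≤m

-- Proposition 4.13 (the argument only uses k ≥ 1).
proposition4p13 : (k : ℕ) → 2 ≤ k → (d : ℕ → ℕ) → (∀ i → 1 ≤ i → 1 ≤ d i) →
    (n : ℕ) → 1 ≤ n → FreeEq (G k d n 1) (reverse (G k d (n ∸ 1) (k ∸ 1)))
proposition4p13 (suc k′) _ d d-pos (suc m) _ = begin
  reduce (inv (Dshift k d (suc m) 1) ++ S (suc m))
    ≡⟨ cong (λ z → reduce (inv z ++ S (suc m))) (Dshift-nonneg k d (suc m) 1 (s≤s z≤n)) ⟩
  reduce (inv Dm ++ S (suc m))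
    ≡⟨ reduce-congˡ (inv Dm) s-next ⟩
  reduce (inv Dm ++ (P m ++ inv E))
    ≡⟨ cong (λ z → reduce (inv Dm ++ (z ++ inv E))) (P≡D-reverse-s m) ⟩
  reduce (inv Dm ++ ((Dm ++ reverse (S m)) ++ inv E))
    ≡⟨ cong (λ z → reduce (inv Dm ++ z)) (++-assoc Dm (reverse (S m)) (inv E)) ⟩
  reduce (inv Dm ++ (Dm ++ (reverse (S m) ++ inv E)))
    ≡⟨ inv-cancelˡ Dm (reverse (S m) ++ inv E) ⟩
  reduce (reverse (S m) ++ inv E)
    ≡⟨ cong (λ z → reduce (reverse (S m) ++ z)) (inv-palindrome E E-palindrome) ⟨
  reduce (reverse (S m) ++ reverse (inv E))
    ≡⟨ cong reduce (reverse-++ (inv E) (S m)) ⟨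
  reduce (reverse (inv E ++ S m)) ∎
  where
  open Sequence k′ d
  open Positive d-pos
  open Step k′ d d-pos m
  Dm : Word
  Dm = D k d m
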